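{- Let $p<q$ be prime numbers, $N=pq$, and let $i,s$ be the integers with $q=ip+s$ and $s\in\{1,\ldots,p-1\}$. If $(i+1)p\in\mathbb{Z}\text{ - }\mathcal{KS}(N)$ and $s>1$, then there exists $k_1\in\mathbb{N}\setminus\{0,1\}$ such that $\frac{(k_1-1)q}{(i+1)k_1-1}\in(\mathbb{Q}\setminus\mathbb{Z})\text{ - }\mathcal{KS}(N)$.
   Context: For a rational number $\alpha\neq 0$ write $\alpha=\frac{\alpha_1}{\alpha_2}$ with $\alpha_1,\alpha_2$ integers and $\gcd(\alpha_1,\alpha_2)=1$. An integer $N\ge 2$ is called an $\alpha$-Korselt number if $N\neq\alpha$ and $\alpha_2 r-\alpha_1$ divides $\alpha_2 N-\alpha_1$ (in $\mathbb{Z}$; $0$ divides only $0$) for every prime divisor $r$ of $N$. For a subset $\mathbb{A}\subseteq\mathbb{Q}$, $\mathbb{A}\text{ - }\mathcal{KS}(N)$ denotes the set of all $\beta\in\mathbb{A}\setminus\{0,N\}$ such that $N$ is a $\beta$-Korselt number. -}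

module Defs where

open import Data.Nat using (ℕ; _≤_)
open import Data.Nat.Primality using (Prime)
import Data.Nat.Divisibility as ℕD
open import Data.Integer using (ℤ; +_; _*_; _-_)
open import Data.Integer.Divisibility using (_∣_)
open import Data.Rational using (ℚ; ↥_; ↧_; ↧ₙ_; 0ℚ)
import Data.Rational as ℚ
open import Data.Product using (_×_)
open import Relation.Binary.PropositionalEquality using (_≡_; _≢_)

-- α = α₁/α₂ in lowest terms: α₁ = ↥ α, α₂ = ↧ α (> 0, coprime by construction).
-- N is an α-Korselt number: N ≥ 2, N ≠ α, and for every prime r ∣ N,
-- (α₂ r − α₁) ∣ (α₂ N − α₁) in ℤ (ℤ-divisibility: 0 divides only 0).
IsKorselt : ℚ → ℕ → Set
IsKorselt α N =
  (2 ≤ N) × (α ≢ (+ N ℚ./ 1)) ×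
  (∀ (r : ℕ) → Prime r → r ℕD.∣ N →
     ((↧ α) * (+ r) - (↥ α)) ∣ ((↧ α) * (+ N) - (↥ α)))

InKS : (ℚ → Set) → ℚ → ℕ → Set
InKS A β N = A β × (β ≢ 0ℚ) × (β ≢ (+ N ℚ./ 1)) × IsKorselt β N

IsInt : ℚ → Set
IsInt β = ↧ₙ β ≡ 1

NonInt : ℚ → Set
NonInt β = ↧ₙ β ≢ 1

module Submission where

-- Proposition 4.3.  Write s = 1 + u and p = s + d, so u ≥ 1, d ≥ 1 and
-- q = i·p + s.  The proof has three ingredients.
--  (1) For a fraction β = b/a (a > 0, not necessarily in lowest terms) the
--      Korselt condition of N at a prime r reads |a·r − b| ∣ |a·N − b| in ℕ:
--      the reduced numerator and denominator of β are b and a divided by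
--      gcd(b,a), and that common factor cancels from the divisibility.
--  (2) For the integer base (i+1)p the conditions at r = p and r = q say
--      i·p ∣ p·c and d ∣ p·c with c = q − (i+1) = i(u+d) + u = i·d + (i+1)u.
--      Since d is coprime to p and to i+1 (a common factor would divide the
--      prime q), this gives i ∣ u and d ∣ u.
--  (3) Write u = m·d (m ≥ 1), k₁ = m+1, a = (i+1)k₁ − 1 = m + i(m+1) and
--      b = m·q.  The key identity a·p + 1 = (m+1)·q gives |a·p − b| = q − 1,
--      |a·q − b| = i(m+1)q and |a·pq − b| = (q − 1)(m+1)q; the first two
--      divide the third because i ∣ q − 1.  The key identity also makes a
--      coprime to q, and a > m, so a ∤ m·q: the base b/a is not an integer.

open import Defs
open import Data.Nat using (ℕ; suc; _+_; _*_; _∸_; _≤_; _<_; NonZero)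
open import Data.Nat.Primality using (Prime)
open import Data.Integer using (+_)
open import Data.Rational using (ℚ; _/_)
open import Data.Product using (Σ; _×_)
open import Relation.Binary.PropositionalEquality using (_≡_)

open import Data.Nat as ℕ using (zero; z≤n; s≤s)
import Data.Nat.Properties as ℕP
open import Data.Nat.Divisibility as ℕD using (_∣_; divides)
open import Data.Nat.Coprimality as Coprimality using (Coprime; coprime-divisor; prime⇒coprime)
import Data.Nat.GCD as ℕG
open import Data.Nat.Primality
  using (euclidsLemma; prime⇒irreducible; ¬prime[1]; prime⇒nonZero; prime⇒nonTrivial)
open import Data.Integer as ℤ using (ℤ; ∣_∣; _⊖_)
import Data.Integer.Properties as ℤP
import Data.Integer.Divisibility as ℤD
import Data.Integer.Tactic.RingSolver as ℤRing
import Data.Nat.Tactic.RingSolver as ℕRing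
open import Data.Rational using (↥_; ↧_; ↧ₙ_; 0ℚ)
import Data.Rational.Properties as ℚP
open import Data.Product using (_,_; ∃)
open import Data.Sum as Sum using (_⊎_; inj₁; inj₂)
open import Data.Empty using (⊥-elim)
open import Function.Bundles using (_⇔_; mk⇔; Equivalence)
open import Relation.Nullary using (¬_; contradiction)
open import Relation.Binary.PropositionalEquality
  using (_≢_; refl; sym; trans; cong; cong₂; subst; subst₂; module ≡-Reasoning)

-- The distance |a·r − b| in ℕ.  For the base b/a the Korselt condition of N
-- at r becomes  gap b a r ∣ gap b a N  (korselt-at⇔ below).
gap : ℕ → ℕ → ℕ → ℕ
gap b a r = ∣ a * r ⊖ b ∣

gap-above : ∀ {b a r} X → a * r ≡ X + b → gap b a r ≡ X
gap-above {b} {a} {r} X ar≡X+b = begin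
  ∣ a * r ⊖ b ∣    ≡⟨ cong (λ z → ∣ z ⊖ b ∣) ar≡X+b ⟩
  ∣ (X + b) ⊖ b ∣  ≡⟨ cong ∣_∣ (ℤP.⊖-≥ (ℕP.m≤n+m b X)) ⟩
  X + b ∸ b        ≡⟨ ℕP.m+n∸n≡m X b ⟩
  X                ∎
  where open ≡-Reasoning

gap-below : ∀ {b a r} X → b ≡ a * r + X → gap b a r ≡ X
gap-below {a = a} {r} X refl =
  trans (ℤP.∣⊖∣-≤ (ℕP.m≤m+n (a * r) X)) (ℕP.m+n∸m≡n (a * r) X)

∣a*r-b∣≡gap : ∀ b a r → ∣ + a ℤ.* + r ℤ.- + b ∣ ≡ gap b a r
∣a*r-b∣≡gap b a r =
  cong ∣_∣ (trans (cong (ℤ._- + b) (sym (ℤP.pos-* a r))) (ℤP.m-n≡m⊖n (a * r) b))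

module Fraction (b a : ℕ) .{{_ : NonZero a}} where

  β : ℚ
  β = + b / a

  g : ℕ
  g = ℕG.gcd b a

  instance
    g≢0 : NonZero g
    g≢0 = ℕ.≢-nonZero (ℕG.gcd[m,n]≢0 b a (inj₂ (ℕ.≢-nonZero⁻¹ a)))

  numerator-scaled : ∣ ↥ β ∣ * g ≡ b
  numerator-scaled = trans (sym (ℤP.abs-* (↥ β) (+ g))) (cong ∣_∣ (ℚP.↥-/ (+ b) a))

  denominator-scaled : ↧ₙ β * g ≡ a
  denominator-scaled = trans (sym (ℤP.abs-* (↧ β) (+ g))) (cong ∣_∣ (ℚP.↧-/ (+ b) a))

  korselt-term : ℕ → ℤ
  korselt-term r = ↧ β ℤ.* + r ℤ.- ↥ β

  korselt-scaled : ∀ r → korselt-term r ℤ.* + g ≡ + a ℤ.* + r ℤ.- + b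
  korselt-scaled r = begin
    korselt-term r ℤ.* + g                ≡⟨ distribute (↧ β) (↥ β) (+ r) (+ g) ⟩
    (↧ β ℤ.* + g) ℤ.* + r ℤ.- ↥ β ℤ.* + g ≡⟨ cong₂ (λ x y → x ℤ.* + r ℤ.- y)
                                                   (ℚP.↧-/ (+ b) a) (ℚP.↥-/ (+ b) a) ⟩
    + a ℤ.* + r ℤ.- + b                   ∎
    where
    open ≡-Reasoning
    distribute : ∀ v u r g → (v ℤ.* r ℤ.- u) ℤ.* g ≡ (v ℤ.* g) ℤ.* r ℤ.- u ℤ.* g
    distribute = ℤRing.solve-∀

  korselt-at⇔ : ∀ r N → korselt-term r ℤD.∣ korselt-term N ⇔ gap b a r ∣ gap b a N
  korselt-at⇔ r N = mk⇔
    (λ d → subst₂ _∣_ (scaled r) (scaled N)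
             (ℤD.*-monoˡ-∣ (+ g) {korselt-term r} {korselt-term N} d))
    (λ d → ℤD.*-cancelʳ-∣ (+ g) {korselt-term r} {korselt-term N}
             (subst₂ _∣_ (sym (scaled r)) (sym (scaled N)) d))
    where
    scaled : ∀ n → ∣ korselt-term n ℤ.* + g ∣ ≡ gap b a n
    scaled n = trans (cong ∣_∣ (korselt-scaled n)) (∣a*r-b∣≡gap b a n)

  integral⇒∣ : IsInt β → a ∣ b
  integral⇒∣ den≡1 = divides ∣ ↥ β ∣ (trans (sym numerator-scaled) (cong (∣ ↥ β ∣ *_) g≡a))
    where
    g≡a : g ≡ a
    g≡a = trans (sym (ℕP.*-identityˡ g)) (trans (cong (_* g) (sym den≡1)) denominator-scaled)

  β≡0⇒b≡0 : β ≡ 0ℚ → b ≡ 0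
  β≡0⇒b≡0 β≡0 = trans (sym numerator-scaled) (cong (λ z → ∣ ↥ z ∣ * g) β≡0)

integer-isInt : ∀ n → IsInt (+ n / 1)
integer-isInt n = ℕP.m*n≡1⇒m≡1 _ _ (Fraction.denominator-scaled n 1)

prime∣prime⇒≡ : ∀ {r p} → Prime r → Prime p → r ∣ p → r ≡ p
prime∣prime⇒≡ pr pp r∣p with prime⇒irreducible pp r∣p
... | inj₁ refl = ⊥-elim (¬prime[1] pr)
... | inj₂ r≡p = r≡p

prime-factor-of-pq : ∀ {r p q} → Prime r → Prime p → Prime q → r ∣ p * q → r ≡ p ⊎ r ≡ q
prime-factor-of-pq {p = p} {q} pr pp pq r∣pq =
  Sum.map (prime∣prime⇒≡ pr pp) (prime∣prime⇒≡ pr pq) (euclidsLemma p q pr r∣pq)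

integer-base-gaps : ∀ n {N} → InKS IsInt (+ n / 1) N →
                    ∀ r → Prime r → r ∣ N → gap n 1 r ∣ gap n 1 N
integer-base-gaps n {N} (_ , _ , _ , (_ , _ , korselt)) r pr r∣N =
  Equivalence.to (Fraction.korselt-at⇔ n 1 r N) (korselt r pr r∣N)

-- A non-integral base b/a lies in (ℚ∖ℤ)-KS(pq) as soon as its gap conditions
-- at the two prime factors hold (b ≠ 0 is automatic, since a ∣ 0).
nonintegral-base-in-KS : ∀ {p q b a} .{{_ : NonZero a}} → Prime p → Prime q → ¬ (a ∣ b) →
  gap b a p ∣ gap b a (p * q) → gap b a q ∣ gap b a (p * q) →
  InKS NonInt (+ b / a) (p * q)
nonintegral-base-in-KS {p} {q} {b} {a} pp pq a∤b at-p at-q =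
  nonint , β≢0 , β≢N , (2≤pq , β≢N , korselt)
  where
  open Fraction b a

  nonint : NonInt β
  nonint isInt = a∤b (integral⇒∣ isInt)

  β≢0 : β ≢ 0ℚ
  β≢0 β≡0 = a∤b (subst (a ∣_) (sym (β≡0⇒b≡0 β≡0)) (a ℕD.∣0))

  β≢N : β ≢ + (p * q) / 1
  β≢N β≡N = nonint (trans (cong ↧ₙ_ β≡N) (integer-isInt (p * q)))

  2≤pq : 2 ≤ p * q
  2≤pq = ℕP.≤-trans (ℕ.nonTrivial⇒n>1 p {{prime⇒nonTrivial pp}})
                    (ℕP.m≤m*n p q {{prime⇒nonZero pq}})

  korselt : ∀ r → Prime r → r ∣ p * q → korselt-term r ℤD.∣ korselt-term (p * q)
  korselt r pr r∣pq with prime-factor-of-pq pr pp pq r∣pq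
  ... | inj₁ refl = Equivalence.from (korselt-at⇔ p (p * q)) at-p
  ... | inj₂ refl = Equivalence.from (korselt-at⇔ q (p * q)) at-q

coprime-below-prime : ∀ {q d x} .{{_ : NonZero d}} → Prime q → d < q →
                      (∀ {c} → c ∣ d → c ∣ x → c ∣ q) → Coprime d x
coprime-below-prime pq d<q common (c∣d , c∣x) with prime⇒irreducible pq (common c∣d c∣x)
... | inj₁ c≡1 = c≡1
... | inj₂ refl = contradiction d<q (ℕP.≤⇒≯ (ℕD.∣⇒≤ c∣d))

complement : ∀ {s p} → 1 ≤ s → s ≤ p ∸ 1 → ∃ λ d → NonZero d × p ≡ s + d
complement {p = zero} (s≤s _) ()
complement {s} {suc p′} _ s≤p′ with ℕP.m≤n⇒∃[o]m+o≡n s≤p′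
... | o , s+o≡p′ = suc o , _ , trans (cong suc (sym s+o≡p′)) (sym (ℕP.+-suc s o))

base-divisibility : ∀ {p q i u d} .{{_ : NonZero d}} → Prime p → Prime q → p < q →
  p ≡ suc u + d → q ≡ i * p + suc u →
  gap (suc i * p) 1 p ∣ gap (suc i * p) 1 (p * q) →
  gap (suc i * p) 1 q ∣ gap (suc i * p) 1 (p * q) →
  (i ∣ u) × (d ∣ u)
base-divisibility {i = i} {u} {d} pp pq p<q refl refl at-p at-q = i∣u , d∣u
  where
  p q c : ℕ
  p = suc u + d
  q = i * p + suc u
  c = i * (u + d) + u     -- q − (i + 1)

  d<p : d < p
  d<p = s≤s (ℕP.m≤n+m d u)

  gap-pq : gap (suc i * p) 1 (p * q) ≡ p * c
  gap-pq = gap-above {suc i * p} {1} {p * q} (p * c) (identity i u d)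
    where
    identity : ∀ i u d → 1 * (suc (u + d) * (i * suc (u + d) + suc u))
                         ≡ suc (u + d) * (i * (u + d) + u) + suc i * suc (u + d)
    identity = ℕRing.solve-∀

  gap-p : gap (suc i * p) 1 p ≡ p * i
  gap-p = gap-below {suc i * p} {1} {p} (p * i) (identity i p)
    where
    identity : ∀ i p → suc i * p ≡ 1 * p + p * i
    identity = ℕRing.solve-∀

  gap-q : gap (suc i * p) 1 q ≡ d
  gap-q = gap-below {suc i * p} {1} {q} d (identity i u d)
    where
    identity : ∀ i u d → suc i * suc (u + d) ≡ 1 * (i * suc (u + d) + suc u) + d
    identity = ℕRing.solve-∀

  i∣u : i ∣ u
  i∣u = ℕD.∣m+n∣m⇒∣n i∣c (ℕD.m∣m*n (u + d))
    where
    i∣c : i ∣ c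
    i∣c = ℕD.*-cancelˡ-∣ p (subst₂ _∣_ gap-p gap-pq at-p)

  -- a common divisor of d and i + 1 divides q = (i+1)(u+1) + i·d
  d⊥i+1 : Coprime d (suc i)
  d⊥i+1 = coprime-below-prime pq (ℕP.<-trans d<p p<q) λ {e} e∣d e∣i+1 →
    subst (e ∣_) (sym (identity i u d))
      (ℕD.∣m∣n⇒∣m+n (ℕD.∣-trans e∣i+1 (ℕD.m∣m*n (suc u))) (ℕD.∣-trans e∣d (ℕD.n∣m*n i)))
    where
    identity : ∀ i u d → i * suc (u + d) + suc u ≡ suc i * suc u + i * d
    identity = ℕRing.solve-∀

  d∣u : d ∣ u
  d∣u = coprime-divisor d⊥i+1 (ℕD.∣m+n∣m⇒∣n (subst (d ∣_) (identity i u d) d∣c) (ℕD.n∣m*n i))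
    where
    d∣c : d ∣ c
    d∣c = coprime-divisor (Coprimality.sym (prime⇒coprime pp d<p))
                          (subst₂ _∣_ gap-q gap-pq at-q)
    identity : ∀ i u d → i * (u + d) + u ≡ i * d + suc i * u
    identity = ℕRing.solve-∀

coprime-of-key : ∀ {a p q k} → suc (a * p) ≡ k * q → Coprime a q
coprime-of-key {a} {p} {k = k} key {e} (e∣a , e∣q) = ℕD.∣1⇒≡1 (ℕD.∣m+n∣m⇒∣n e∣ap+1 e∣ap)
  where
  e∣ap+1 : e ∣ a * p + 1
  e∣ap+1 = subst (e ∣_) (trans (sym key) (ℕP.+-comm 1 (a * p))) (ℕD.∣-trans e∣q (ℕD.n∣m*n k))
  e∣ap : e ∣ a * p
  e∣ap = ℕD.∣-trans e∣a (ℕD.m∣m*n p)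

∣-nonZero : ∀ {e n} .{{_ : NonZero n}} → e ∣ n → NonZero e
∣-nonZero {zero} {n} 0∣n = contradiction (ℕD.0∣⇒≡0 0∣n) (ℕ.≢-nonZero⁻¹ n)
∣-nonZero {suc e} _ = _

candidate-in-KS : ∀ {p q i u m d} .{{_ : NonZero i}} .{{_ : NonZero m}}
  .{{_ : NonZero (m + i * suc m)}} → Prime p → Prime q →
  p ≡ suc u + d → q ≡ suc (i * p + u) → u ≡ m * d → i ∣ u →
  InKS NonInt (+ (m * q) / (m + i * suc m)) (p * q)
candidate-in-KS {i = i} {m = m} {d} pp pq refl refl refl i∣u =
  nonintegral-base-in-KS pp pq a∤b
    (subst₂ _∣_ (sym gap-p) (sym gap-pq) (ℕD.m∣m*n (suc m * q)))
    (subst₂ _∣_ (sym gap-q) (sym gap-pq) (ℕD.*-pres-∣ i∣c (ℕD.∣-refl {suc m * q})))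
  where
  p c q a : ℕ
  p = suc (m * d) + d
  c = i * p + m * d
  q = suc c
  a = m + i * suc m

  key : suc (a * p) ≡ suc m * q
  key = identity i m d
    where
    identity : ∀ i m d → suc ((m + i * suc m) * suc (m * d + d))
                         ≡ suc m * suc (i * suc (m * d + d) + m * d)
    identity = ℕRing.solve-∀

  ap≡c+mq : a * p ≡ c + m * q
  ap≡c+mq = ℕP.suc-injective key

  gap-p : gap (m * q) a p ≡ c
  gap-p = gap-above {m * q} {a} {p} c ap≡c+mq

  gap-q : gap (m * q) a q ≡ i * (suc m * q)
  gap-q = gap-above {m * q} {a} {q} (i * (suc m * q)) (identity i m q)
    where
    identity : ∀ i m q → (m + i * suc m) * q ≡ i * (suc m * q) + m * q
    identity = ℕRing.solve-∀

  gap-pq : gap (m * q) a (p * q) ≡ c * (suc m * q)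
  gap-pq = gap-above {m * q} {a} {p * q} (c * (suc m * q)) (begin
    a * (p * q)     ≡⟨ ℕP.*-assoc a p q ⟨
    a * p * q       ≡⟨ cong (_* q) ap≡c+mq ⟩
    (c + m * q) * q ≡⟨ identity m c ⟩
    c * (suc m * q) + m * q ∎)
    where
    open ≡-Reasoning
    identity : ∀ m c → (c + m * suc c) * suc c ≡ c * (suc m * suc c) + m * suc c
    identity = ℕRing.solve-∀

  i∣c : i ∣ c
  i∣c = ℕD.∣m∣n⇒∣m+n (ℕD.m∣m*n p) i∣u

  -- a is coprime to q by the key identity, and a > m ≥ 1, so a ∤ m·q
  a∤b : ¬ (a ∣ m * q)
  a∤b a∣mq = ℕP.<⇒≱ m<a (ℕD.∣⇒≤ a∣m)
    where
    a∣m : a ∣ m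
    a∣m = coprime-divisor {a} {q} {m} (coprime-of-key {k = suc m} key)
                          (subst (a ∣_) (ℕP.*-comm m q) a∣mq)
    m<a : m < a
    m<a = ℕP.m<m+n m (ℕ.>-nonZero⁻¹ (i * suc m) {{ℕP.m*n≢0 i (suc m)}})

proposition4p3 : (p q i s : ℕ) → Prime p → Prime q → p < q →
    q ≡ i * p + s → 1 ≤ s → s ≤ p ∸ 1 →
    InKS IsInt (+ (suc i * p) / 1) (p * q) →
    1 < s →
    Σ ℕ (λ k₁ → (2 ≤ k₁) × Σ (NonZero (suc i * k₁ ∸ 1)) (λ nz →
      InKS NonInt ((+ ((k₁ ∸ 1) * q) / (suc i * k₁ ∸ 1)) {{nz}}) (p * q)))
proposition4p3 p q i (suc u) pp pq p<q q≡ip+s 1≤s s≤p∸1 base∈KS (s≤s 1≤u)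
  with complement 1≤s s≤p∸1
... | d , d≢0 , p≡s+d
  with base-divisibility {{d≢0}} pp pq p<q p≡s+d q≡ip+s
         (integer-base-gaps (suc i * p) base∈KS p pp (ℕD.m∣m*n q))
         (integer-base-gaps (suc i * p) base∈KS q pq (ℕD.n∣m*n p))
... | _ , divides zero refl = contradiction 1≤u λ ()
... | i∣u , divides (suc k) u≡md =
  suc m , s≤s (s≤s z≤n) , _ ,
  candidate-in-KS {i = i} {m = m} {{∣-nonZero {{ℕ.>-nonZero 1≤u}} i∣u}} pp pq p≡s+d
    (trans q≡ip+s (ℕP.+-suc (i * p) u)) u≡md i∣u
  where
  m : ℕ
  m = suc k
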